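{- Let $C$ be a $2$-neighbour-transitive code in the odd graph $O_{k+1}=K(2k+1,k)$ with minimum distance $\delta\geq 5$. Then $C$ is also a code in the Johnson graph $J(2k+1,k)$ (which has the same vertex set as $O_{k+1}$), and as a code in $J(2k+1,k)$, $C$ is neighbour-transitive with minimum distance $\delta'\geq 3$.
   Context: Let $k\geq 2$ and let $\Omega$ be a set with $|\Omega|=2k+1$. The odd graph $O_{k+1}=K(2k+1,k)$ has as vertices the $k$-subsets of $\Omega$, adjacent iff disjoint. The Johnson graph $J(2k+1,k)$ has the same vertex set, two $k$-subsets being adjacent iff they intersect in exactly $k-1$ elements. Both graphs have automorphism group $\mathrm{Sym}(\Omega)$. For a graph $\varGamma$, a code $C$ is a set of vertices with $|C|\geq 2$; with $d$ the graph distance, the minimum distance is the least distance between distinct codewords; $C_i$ is the set of vertices $\gamma$ with $\min_{\alpha\in C}d(\alpha,\gamma)=i$, and the covering radius $\rho$ is the largest $i$ with $C_i\ne\emptyset$. $\mathrm{Aut}(C)$ is the setwise stabiliser of $C$ in $\mathrm{Aut}(\varGamma)$. $C$ is neighbour-transitive if $\rho\ge1$ and $\mathrm{Aut}(C)$ is transitive on $C$ and $C_1$; $2$-neighbour-transitive if $\rho\geq 2$ and $\mathrm{Aut}(C)$ is transitive on $C$, $C_1$ and $C_2$. -}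

module Defs where

open import Data.Nat using (ℕ; zero; suc; _+_; _*_; _∸_; _<_; _≤_)
open import Data.Fin using (Fin)
open import Data.Fin.Subset using (Subset; _∩_; ∣_∣; Empty)
open import Data.Fin.Permutation using (Permutation′; _⟨$⟩ˡ_)
open import Data.Vec using (tabulate; lookup)
open import Data.Product using (Σ; _×_; ∃)
open import Relation.Nullary using (¬_)
open import Relation.Binary.PropositionalEquality using (_≡_)

IsVertex : (n k : ℕ) → Subset n → Set
IsVertex n k s = ∣ s ∣ ≡ k

Adj : ℕ → Set₁
Adj n = Subset n → Subset n → Set

OddAdj : (n k : ℕ) → Adj n
OddAdj n k s t = IsVertex n k s × IsVertex n k t × Empty (s ∩ t)

JohnsonAdj : (n k : ℕ) → Adj n
JohnsonAdj n k s t = IsVertex n k s × IsVertex n k t × ∣ s ∩ t ∣ ≡ k ∸ 1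

data Walk {n : ℕ} (A : Adj n) : Subset n → Subset n → ℕ → Set where
  here : ∀ {x} → Walk A x x 0
  step : ∀ {x y z m} → A x y → Walk A y z m → Walk A x z (suc m)

Dist : ∀ {n} → Adj n → Subset n → Subset n → ℕ → Set
Dist A x y i = Walk A x y i × (∀ j → j < i → ¬ Walk A x y j)

Code : ℕ → Set₁
Code n = Subset n → Set

-- Action of Sym(Ω) on subsets: σ·s = { σ(a) | a ∈ s }.
act : ∀ {n} → Permutation′ n → Subset n → Subset n
act σ s = tabulate (λ j → lookup s (σ ⟨$⟩ˡ j))

IsCode : (n k : ℕ) → Code n → Set
IsCode n k C =
  (∀ s → C s → IsVertex n k s) ×
  Σ (Subset n) λ a → Σ (Subset n) λ b → C a × C b × ¬ (a ≡ b)

MinDistAtLeast : ∀ {n} → Adj n → Code n → ℕ → Set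
MinDistAtLeast A C δ =
  ∀ a b → C a → C b → ¬ (a ≡ b) → ∀ j → j < δ → ¬ Walk A a b j

InC : (n k : ℕ) → Adj n → Code n → ℕ → Subset n → Set
InC n k A C i g =
  IsVertex n k g ×
  (Σ (Subset n) λ a → C a × Walk A a g i) ×
  (∀ a → C a → ∀ j → j < i → ¬ Walk A a g j)

CovRadiusAtLeast : (n k : ℕ) → Adj n → Code n → ℕ → Set
CovRadiusAtLeast n k A C r =
  Σ ℕ λ i → r ≤ i × Σ (Subset n) λ g → InC n k A C i g

-- σ ∈ Aut(C): σ ∈ Sym(Ω) = Aut(Γ) stabilising C setwise (on vertices).
InAutC : (n k : ℕ) → Code n → Permutation′ n → Set
InAutC n k C σ =
  ∀ s → IsVertex n k s → ((C s → C (act σ s)) × (C (act σ s) → C s))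

AutTransitiveOn : (n k : ℕ) → Code n → (Subset n → Set) → Set
AutTransitiveOn n k C P =
  ∀ x y → P x → P y →
    Σ (Permutation′ n) λ σ → InAutC n k C σ × act σ x ≡ y

NeighbourTransitive : (n k : ℕ) → Adj n → Code n → Set
NeighbourTransitive n k A C =
  CovRadiusAtLeast n k A C 1 ×
  AutTransitiveOn n k C C ×
  AutTransitiveOn n k C (InC n k A C 1)

TwoNeighbourTransitive : (n k : ℕ) → Adj n → Code n → Set
TwoNeighbourTransitive n k A C =
  CovRadiusAtLeast n k A C 2 ×
  AutTransitiveOn n k C C ×
  AutTransitiveOn n k C (InC n k A C 1) ×
  AutTransitiveOn n k C (InC n k A C 2)

-- Two k-subsets s, t of a (2k+1)-set meeting in k-1 points have union of
-- size k+1, so the complement of s ∪ t is a k-set disjoint from both: every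
-- Johnson edge is the shadow of an odd-graph path of length 2.  Hence Johnson
-- distances at most 2 give odd-graph distances at most 4 < δ, so δ' ≥ 3.  A
-- Johnson neighbour g of a codeword a is at odd distance 2 from a, and not 1
-- from any codeword b, since a-γ-g-b would be an odd-graph path of length 3
-- with a ≠ b (for k ≥ 2 Johnson and odd edges are disjoint).  So C₁ in J(2k+1,k)
-- lies inside C₂ in O_{k+1}, and Aut(C) is transitive on it.

module Submission where

open import Defs
open import Data.Nat using (ℕ; zero; suc; _+_; _*_; _∸_; _≤_; _<_; s≤s; z≤n)
open import Data.Nat.Properties
  using (+-suc; +-comm; *-suc; +-cancelʳ-≡; m+n∸m≡n; m≤m+n; m<n⇒0<n∸m;
         suc-injective; n≤1+n; ≤-refl; <-≤-trans; *-monoʳ-≤)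
open import Data.Nat.Tactic.RingSolver using (solve-∀)
open import Data.Fin using (Fin; zero; suc)
open import Data.Fin.Subset using (Subset; inside; outside; _∈_; _∉_; _∩_; _∪_; ∁; ∣_∣; Nonempty; Empty)
open import Data.Fin.Subset.Properties
  using (∩-idem; ∩-comm; Empty-unique; ∣⊥∣≡0; ∣∁p∣≡n∸∣p∣; x∈∁p⇒x∉p;
         x∈p∩q⁻; x∈p∪q⁺)
open import Data.Vec using (_∷_; []; here; there)
open import Data.Product using (∃; _×_; _,_)
open import Data.Sum using (inj₁; inj₂)
open import Data.Empty using (⊥-elim)
open import Relation.Nullary using (¬_)
open import Relation.Binary.PropositionalEquality
  using (_≡_; refl; sym; trans; cong; cong₂; subst; module ≡-Reasoning)

private
  variable
    n k m : ℕ

∣p∪q∣+∣p∩q∣≡∣p∣+∣q∣ : (p q : Subset n) → ∣ p ∪ q ∣ + ∣ p ∩ q ∣ ≡ ∣ p ∣ + ∣ q ∣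
∣p∪q∣+∣p∩q∣≡∣p∣+∣q∣ [] [] = refl
∣p∪q∣+∣p∩q∣≡∣p∣+∣q∣ (inside ∷ p) (inside ∷ q) = cong suc (begin
  ∣ p ∪ q ∣ + suc ∣ p ∩ q ∣ ≡⟨ +-suc _ _ ⟩
  suc (∣ p ∪ q ∣ + ∣ p ∩ q ∣) ≡⟨ cong suc (∣p∪q∣+∣p∩q∣≡∣p∣+∣q∣ p q) ⟩
  suc (∣ p ∣ + ∣ q ∣) ≡⟨ +-suc _ _ ⟨
  ∣ p ∣ + suc ∣ q ∣ ∎)
  where open ≡-Reasoning
∣p∪q∣+∣p∩q∣≡∣p∣+∣q∣ (inside ∷ p) (outside ∷ q) = cong suc (∣p∪q∣+∣p∩q∣≡∣p∣+∣q∣ p q)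
∣p∪q∣+∣p∩q∣≡∣p∣+∣q∣ (outside ∷ p) (inside ∷ q) =
  trans (cong suc (∣p∪q∣+∣p∩q∣≡∣p∣+∣q∣ p q)) (sym (+-suc _ _))
∣p∪q∣+∣p∩q∣≡∣p∣+∣q∣ (outside ∷ p) (outside ∷ q) = ∣p∪q∣+∣p∩q∣≡∣p∣+∣q∣ p q

Empty⇒∣p∣≡0 : (p : Subset n) → Empty p → ∣ p ∣ ≡ 0
Empty⇒∣p∣≡0 {n} p e = trans (cong ∣_∣ (Empty-unique e)) (∣⊥∣≡0 n)

0<∣p∣⇒Nonempty : (p : Subset n) → 0 < ∣ p ∣ → Nonempty p
0<∣p∣⇒Nonempty (inside ∷ p) _ = zero , here
0<∣p∣⇒Nonempty (outside ∷ p) 0<∣p∣ with 0<∣p∣⇒Nonempty p 0<∣p∣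
... | x , x∈p = suc x , there x∈p

∣p∣<n⇒Nonempty∁ : (p : Subset n) → ∣ p ∣ < n → Nonempty (∁ p)
∣p∣<n⇒Nonempty∁ {n} p ∣p∣<n =
  0<∣p∣⇒Nonempty (∁ p) (subst (0 <_) (sym (∣∁p∣≡n∸∣p∣ p)) (m<n⇒0<n∸m ∣p∣<n))

insert-∉ : (p : Subset n) (y : Fin n) → y ∉ p →
  ∃ λ q → ∣ q ∣ ≡ suc ∣ p ∣ × ∣ p ∩ q ∣ ≡ ∣ p ∣
insert-∉ (inside ∷ p) zero y∉p = ⊥-elim (y∉p here)
insert-∉ (outside ∷ p) zero _ = inside ∷ p , refl , cong ∣_∣ (∩-idem p)
insert-∉ (s ∷ p) (suc y) y∉p with insert-∉ p y (λ y∈p → y∉p (there y∈p))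
insert-∉ (inside ∷ p) (suc y) _ | q , ∣q∣ , ∣p∩q∣ = inside ∷ q , cong suc ∣q∣ , cong suc ∣p∩q∣
insert-∉ (outside ∷ p) (suc y) _ | q , ∣q∣ , ∣p∩q∣ = outside ∷ q , ∣q∣ , ∣p∩q∣

remove-∈ : (p : Subset n) (x : Fin n) → x ∈ p →
  ∃ λ q → suc ∣ q ∣ ≡ ∣ p ∣ × ∣ p ∩ q ∣ ≡ ∣ q ∣
remove-∈ (inside ∷ p) zero here = outside ∷ p , refl , cong ∣_∣ (∩-idem p)
remove-∈ (s ∷ p) (suc x) (there x∈p) with remove-∈ p x x∈p
remove-∈ (inside ∷ p) (suc x) _ | q , ∣q∣ , ∣p∩q∣ = inside ∷ q , cong suc ∣q∣ , cong suc ∣p∩q∣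
remove-∈ (outside ∷ p) (suc x) _ | q , ∣q∣ , ∣p∩q∣ = outside ∷ q , ∣q∣ , ∣p∩q∣

exchange : (p : Subset n) (x y : Fin n) → x ∈ p → y ∉ p →
  ∃ λ q → ∣ q ∣ ≡ ∣ p ∣ × suc ∣ p ∩ q ∣ ≡ ∣ p ∣
exchange (inside ∷ p) zero zero _ y∉p = ⊥-elim (y∉p here)
exchange (inside ∷ p) zero (suc y) here y∉p with insert-∉ p y (λ y∈p → y∉p (there y∈p))
... | q , ∣q∣ , ∣p∩q∣ = outside ∷ q , ∣q∣ , cong suc ∣p∩q∣
exchange (inside ∷ p) (suc x) zero _ y∉p = ⊥-elim (y∉p here)
exchange (outside ∷ p) (suc x) zero (there x∈p) _ with remove-∈ p x x∈p
... | q , ∣q∣ , ∣p∩q∣ = inside ∷ q , ∣q∣ , trans (cong suc ∣p∩q∣) ∣q∣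
exchange (s ∷ p) (suc x) (suc y) (there x∈p) y∉p with exchange p x y x∈p (λ y∈p → y∉p (there y∈p))
exchange (inside ∷ p) (suc x) (suc y) _ _ | q , ∣q∣ , ∣p∩q∣ = inside ∷ q , cong suc ∣q∣ , cong suc ∣p∩q∣
exchange (outside ∷ p) (suc x) (suc y) _ _ | q , ∣q∣ , ∣p∩q∣ = outside ∷ q , ∣q∣ , ∣p∩q∣

Subdivides : Adj n → Adj n → Set
Subdivides A B = ∀ {x y} → A x y → ∃ λ z → B x z × B z y

module _ {A B : Adj n} (A⇒B² : Subdivides A B) where

  walk-subdivide : ∀ {x y j} → Walk A x y j → Walk B x y (2 * j)
  walk-subdivide here = here
  walk-subdivide {j = suc j} (step xy w) with A⇒B² xy
  ... | z , xz , zy = subst (Walk B _ _) (sym (*-suc 2 j)) (step xz (step zy (walk-subdivide w)))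

  minDist-subdivide : ∀ {C d} → MinDistAtLeast B C (suc (2 * d)) → MinDistAtLeast A C (suc d)
  minDist-subdivide md a b ca cb a≢b j (s≤s j≤d) w =
    md a b ca cb a≢b (2 * j) (s≤s (*-monoʳ-≤ 2 j≤d)) (walk-subdivide w)

minDist-mono : ∀ {A : Adj n} {C δ δ'} → δ' ≤ δ → MinDistAtLeast A C δ → MinDistAtLeast A C δ'
minDist-mono δ'≤δ md a b ca cb a≢b j j<δ' = md a b ca cb a≢b j (<-≤-trans j<δ' δ'≤δ)

AutTransitiveOn-⊆ : ∀ {C} {P Q : Subset n → Set} →
  (∀ x → P x → Q x) → AutTransitiveOn n k C Q → AutTransitiveOn n k C P
AutTransitiveOn-⊆ P⊆Q trans-Q x y px py = trans-Q x y (P⊆Q x px) (P⊆Q y py)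

neighbour∈C₁ : ∀ {A : Adj n} {C a g} → (∀ x → ¬ A x x) → MinDistAtLeast A C 2 →
  C a → A a g → IsVertex n k g → InC n k A C 1 g
neighbour∈C₁ {A = A} {C} {a} {g} irrefl md ca ag vg = vg , (a , ca , step ag here) , g∉C
  where
  g∉C : ∀ b → C b → ∀ j → j < 1 → ¬ Walk A b g j
  g∉C b cb zero _ here = md a b ca cb (λ { refl → irrefl a ag }) 1 ≤-refl (step ag here)
  g∉C b cb (suc j) (s≤s ())

C₁⊆C₂ : ∀ {A B : Adj n} {C} → Subdivides A B → (∀ x y → A x y → ¬ B x y) →
  (∀ {x y} → B x y → B y x) → MinDistAtLeast B C 4 →
  ∀ g → InC n k A C 1 g → InC n k B C 2 g
C₁⊆C₂ {A = A} {B} {C} A⇒B² A∩B=∅ B-sym md g (vg , (a , ca , step ag here) , g∉C) with A⇒B² ag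
... | z , az , zg = vg , (a , ca , step az (step zg here)) , far
  where
  far : ∀ b → C b → ∀ j → j < 2 → ¬ Walk B b g j
  far b cb zero _ here = g∉C b cb 0 (s≤s z≤n) here
  far b cb (suc zero) _ (step bg here) =
    md a b ca cb (λ { refl → A∩B=∅ a g ag bg }) 3 ≤-refl (step az (step zg (step (B-sym bg) here)))
  far b cb (suc (suc j)) (s≤s (s≤s ()))

OddAdj-sym : ∀ {s t} → OddAdj n k s t → OddAdj n k t s
OddAdj-sym {s = s} {t} (vs , vt , s∩t=∅) = vt , vs , subst Empty (∩-comm s t) s∩t=∅

JohnsonAdj-irrefl : ∀ s → ¬ JohnsonAdj n (suc m) s s
JohnsonAdj-irrefl s (vs , _ , ∣s∩s∣) with trans (sym vs) (trans (sym (cong ∣_∣ (∩-idem s))) ∣s∩s∣)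
... | ()

JohnsonAdj⇒¬OddAdj : ∀ s t → JohnsonAdj n (suc (suc m)) s t → ¬ OddAdj n (suc (suc m)) s t
JohnsonAdj⇒¬OddAdj s t (_ , _ , ∣s∩t∣) (_ , _ , s∩t=∅)
  with trans (sym ∣s∩t∣) (Empty⇒∣p∣≡0 (s ∩ t) s∩t=∅)
... | ()

JohnsonAdj-exists : ∀ s → IsVertex n (suc m) s → suc m < n → ∃ (JohnsonAdj n (suc m) s)
JohnsonAdj-exists {n} s vs k<n
  with 0<∣p∣⇒Nonempty s (subst (0 <_) (sym vs) (s≤s z≤n))
     | ∣p∣<n⇒Nonempty∁ s (subst (_< n) (sym vs) k<n)
... | x , x∈s | y , y∈∁s with exchange s x y x∈s (x∈∁p⇒x∉p y∈∁s)
... | t , ∣t∣ , ∣s∩t∣ = t , vs , trans ∣t∣ vs , suc-injective (trans ∣s∩t∣ vs)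

JohnsonAdj-subdivides-OddAdj :
  Subdivides (JohnsonAdj (2 * suc m + 1) (suc m)) (OddAdj (2 * suc m + 1) (suc m))
JohnsonAdj-subdivides-OddAdj {m} {s} {t} (vs , vt , ∣s∩t∣) =
  ∁ (s ∪ t) , (vs , vγ , s∩γ=∅) , (vγ , vt , γ∩t=∅)
  where
  open ≡-Reasoning

  2k+1≡[k+1]+k : ∀ m → 2 * suc m + 1 ≡ suc (suc m) + suc m
  2k+1≡[k+1]+k = solve-∀

  ∣s∪t∣ : ∣ s ∪ t ∣ ≡ suc (suc m)
  ∣s∪t∣ = +-cancelʳ-≡ m _ _ (begin
    ∣ s ∪ t ∣ + m             ≡⟨ cong (∣ s ∪ t ∣ +_) ∣s∩t∣ ⟨
    ∣ s ∪ t ∣ + ∣ s ∩ t ∣     ≡⟨ ∣p∪q∣+∣p∩q∣≡∣p∣+∣q∣ s t ⟩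
    ∣ s ∣ + ∣ t ∣             ≡⟨ cong₂ _+_ vs vt ⟩
    suc m + suc m             ≡⟨ +-suc (suc m) m ⟩
    suc (suc m) + m           ∎)

  vγ : ∣ ∁ (s ∪ t) ∣ ≡ suc m
  vγ = begin
    ∣ ∁ (s ∪ t) ∣                      ≡⟨ ∣∁p∣≡n∸∣p∣ (s ∪ t) ⟩
    2 * suc m + 1 ∸ ∣ s ∪ t ∣          ≡⟨ cong₂ _∸_ (2k+1≡[k+1]+k m) ∣s∪t∣ ⟩
    suc (suc m) + suc m ∸ suc (suc m)  ≡⟨ m+n∸m≡n (suc (suc m)) (suc m) ⟩
    suc m                              ∎

  s∩γ=∅ : Empty (s ∩ ∁ (s ∪ t))
  s∩γ=∅ (x , x∈) with x∈p∩q⁻ s _ x∈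
  ... | x∈s , x∈γ = x∈∁p⇒x∉p x∈γ (x∈p∪q⁺ (inj₁ x∈s))

  γ∩t=∅ : Empty (∁ (s ∪ t) ∩ t)
  γ∩t=∅ (x , x∈) with x∈p∩q⁻ _ t x∈
  ... | x∈γ , x∈t = x∈∁p⇒x∉p x∈γ (x∈p∪q⁺ (inj₂ x∈t))

k<2k+1 : ∀ k → k < 2 * k + 1
k<2k+1 k = subst (k <_) (+-comm 1 (2 * k)) (s≤s (m≤m+n k (k + 0)))

lemma3p2 : (k : ℕ) → 2 ≤ k → (C : Code (2 * k + 1)) →
    IsCode (2 * k + 1) k C →
    TwoNeighbourTransitive (2 * k + 1) k (OddAdj (2 * k + 1) k) C →
    MinDistAtLeast (OddAdj (2 * k + 1) k) C 5 →
    NeighbourTransitive (2 * k + 1) k (JohnsonAdj (2 * k + 1) k) C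
    × MinDistAtLeast (JohnsonAdj (2 * k + 1) k) C 3
lemma3p2 k@(suc (suc m)) (s≤s (s≤s z≤n)) C (C⊆V , a , _ , ca , _) (_ , transC , _ , transC₂) mdO =
  (covering , transC , AutTransitiveOn-⊆ C₁J⊆C₂O transC₂) , mdJ
  where
  J⇒O² : Subdivides (JohnsonAdj (2 * k + 1) k) (OddAdj (2 * k + 1) k)
  J⇒O² = JohnsonAdj-subdivides-OddAdj

  mdJ : MinDistAtLeast (JohnsonAdj (2 * k + 1) k) C 3
  mdJ = minDist-subdivide J⇒O² mdO

  C₁J⊆C₂O : ∀ g → InC (2 * k + 1) k (JohnsonAdj (2 * k + 1) k) C 1 g
                  → InC (2 * k + 1) k (OddAdj (2 * k + 1) k) C 2 g
  C₁J⊆C₂O = C₁⊆C₂ J⇒O² JohnsonAdj⇒¬OddAdj OddAdj-sym (minDist-mono (n≤1+n 4) mdO)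

  covering : CovRadiusAtLeast (2 * k + 1) k (JohnsonAdj (2 * k + 1) k) C 1
  covering with JohnsonAdj-exists a (C⊆V a ca) (k<2k+1 k)
  ... | g , ag@(_ , vg , _) =
    1 , ≤-refl , g , neighbour∈C₁ JohnsonAdj-irrefl (minDist-mono (n≤1+n 2) mdJ) ca ag vg
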